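{- Let $\Gamma$ be a distance-regular graph with diameter $D\ge3$, and let $\theta,\theta'$ be distinct elements of $\mathbb{C}\cup\{\infty\}$. Then $\mathbf{M}(\theta)\cap\mathbf{M}(\theta')=0$.
   Context: $\Gamma$ is a finite connected distance-regular graph with diameter $D$; $A_i$ is its $i$th distance matrix ($yz$-entry $1$ if the distance between $y,z$ is $i$, else $0$), $A=A_1$, and $\mathbf{M}$ is the Bose–Mesner algebra (the algebra generated by $A$, with basis $A_0,\dots,A_D$). For $\theta\in\mathbb{C}$, $\mathbf{M}(\theta)=\{Y\in\mathbf{M}:(A-\theta I)Y\in\mathbb{C}A_D\}$; and $\mathbf{M}(\infty)=\mathbb{C}A_D$. -}

module Defs where

open import Level using (Level; _⊔_; Lift) renaming (suc to lsuc)
open import Algebra.Bundles using (CommutativeRing)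
open import Data.Nat as ℕ using (ℕ; zero; suc; _≤_; _<_; _≥_)
open import Data.Fin using (Fin; zero; suc; toℕ)
open import Data.Bool using (Bool; true; false; _∧_; _∨_; not; if_then_else_)
open import Data.Maybe using (Maybe; just; nothing)
open import Data.Product using (Σ; ∃; _×_; _,_)
open import Data.Empty using (⊥)
open import Data.Unit using (⊤)
open import Relation.Nullary using (¬_)
open import Relation.Binary.PropositionalEquality using (_≡_)

anyF : ∀ {n} → (Fin n → Bool) → Bool
anyF {ℕ.zero}  p = false
anyF {ℕ.suc n} p = p zero ∨ anyF (λ i → p (suc i))

countF : ∀ {n} → (Fin n → Bool) → ℕ
countF {ℕ.zero}  p = 0
countF {ℕ.suc n} p = (if p zero then 1 else 0) ℕ.+ countF (λ i → p (suc i))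

record SimpleGraph (n : ℕ) : Set where
  field
    adj       : Fin n → Fin n → Bool
    adj-sym   : ∀ x y → adj x y ≡ adj y x
    adj-irref : ∀ x → adj x x ≡ false

open SimpleGraph public

eqF : ∀ {n} → Fin n → Fin n → Bool
eqF zero    zero    = true
eqF zero    (suc _) = false
eqF (suc _) zero    = false
eqF (suc x) (suc y) = eqF x y

-- within G x y i = true iff there is a walk of length ≤ i from x to y
within : ∀ {n} → SimpleGraph n → Fin n → Fin n → ℕ → Bool
within G x y zero    = eqF x y
within G x y (suc i) = within G x y i ∨ anyF (λ z → within G x z i ∧ adj G z y)

atDist : ∀ {n} → SimpleGraph n → Fin n → Fin n → ℕ → Bool
atDist G x y zero    = within G x y zero
atDist G x y (suc i) = within G x y (suc i) ∧ not (within G x y i)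

Connected : ∀ {n} → SimpleGraph n → Set
Connected {n} G = ∀ (x y : Fin n) → ∃ λ i → atDist G x y i ≡ true

HasDiameter : ∀ {n} → SimpleGraph n → ℕ → Set
HasDiameter {n} G D =
  (∀ (x y : Fin n) (i : ℕ) → atDist G x y i ≡ true → i ≤ D) ×
  (∃ λ (x : Fin n) → ∃ λ (y : Fin n) → atDist G x y D ≡ true)

DistanceRegular : ∀ {n} → SimpleGraph n → Set
DistanceRegular {n} G =
  Connected G ×
  (∀ (h i j : ℕ) → ∃ λ (p : ℕ) → ∀ (x y : Fin n) → atDist G x y h ≡ true →
      countF (λ z → atDist G x z i ∧ atDist G y z j) ≡ p)

record Field c ℓ : Set (lsuc (c ⊔ ℓ)) where
  field
    commRing : CommutativeRing c ℓ
  open CommutativeRing commRing public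
  field
    1≉0     : ¬ (1# ≈ 0#)
    inverse : ∀ x → ¬ (x ≈ 0#) → ∃ λ y → (x * y) ≈ 1#

module _ {c ℓ} (F : Field c ℓ) where
  open Field F using (Carrier; _≈_; _+_; _*_; _-_; 0#; 1#)

  natF : ℕ → Carrier
  natF zero    = 0#
  natF (suc m) = 1# + natF m

  CharZero : Set ℓ
  CharZero = ∀ (m : ℕ) → ¬ (natF (suc m) ≈ 0#)

  Mat : ℕ → Set c
  Mat n = Fin n → Fin n → Carrier

  sumF : ∀ {n} → (Fin n → Carrier) → Carrier
  sumF {ℕ.zero}  f = 0#
  sumF {ℕ.suc n} f = f zero + sumF (λ i → f (suc i))

  _≈M_ : ∀ {n} → Mat n → Mat n → Set ℓ
  Y ≈M Z = ∀ x y → Y x y ≈ Z x y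

  _·M_ : ∀ {n} → Mat n → Mat n → Mat n
  (Y ·M Z) x y = sumF (λ z → Y x z * Z z y)

  _-M_ : ∀ {n} → Mat n → Mat n → Mat n
  (Y -M Z) x y = Y x y - Z x y

  scal : ∀ {n} → Carrier → Mat n → Mat n
  scal a Y x y = a * Y x y

  boolF : Bool → Carrier
  boolF true  = 1#
  boolF false = 0#

  idM : ∀ {n} → Mat n
  idM x y = boolF (eqF x y)

  distMat : ∀ {n} → SimpleGraph n → ℕ → Mat n
  distMat G i x y = boolF (atDist G x y i)

  adjMat : ∀ {n} → SimpleGraph n → Mat n
  adjMat G = distMat G 1

  InBM : ∀ {n} → SimpleGraph n → ℕ → Mat n → Set (c ⊔ ℓ)
  InBM {n} G D Y = ∃ λ (a : Fin (suc D) → Carrier) →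
    Y ≈M (λ x y → sumF (λ i → a i * distMat G (toℕ i) x y))

  -- M(θ) for θ ∈ F ∪ {∞}; nothing represents ∞
  InMθ : ∀ {n} → SimpleGraph n → ℕ → Maybe Carrier → Mat n → Set (c ⊔ ℓ)
  InMθ G D (just θ) Y = InBM G D Y ×
    (∃ λ (b : Carrier) → ((adjMat G -M scal θ idM) ·M Y) ≈M scal b (distMat G D))
  InMθ G D nothing  Y = ∃ λ (b : Carrier) → Y ≈M scal b (distMat G D)

  DistinctExt : Maybe Carrier → Maybe Carrier → Set ℓ
  DistinctExt (just a) (just b) = ¬ (a ≈ b)
  DistinctExt (just _) nothing  = Lift ℓ ⊤
  DistinctExt nothing  (just _) = Lift ℓ ⊤
  DistinctExt nothing  nothing  = Lift ℓ ⊥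

{-# OPTIONS --safe #-}
module Submission where

-- If θ and θ′ are both finite, subtracting (A − θ′I)Y = b′A_D from (A − θI)Y = bA_D
-- gives (θ′ − θ)Y = (b − b′)A_D, so in every case Y = kA_D with (A − θI)Y = bA_D for
-- some finite θ. Take u, v at distance D and a neighbour z of u closer to v. The (z, v)
-- entry of A·A_D counts the neighbours of z at distance D from v, u among them, while
-- (A_D)_{zv} = 0; so the (z, v) entry of (A − θI)(kA_D) = bA_D reads k·c = 0 with c ≥ 1,
-- and k = 0 in characteristic zero.

open import Defs
open import Level using (lift)
open import Data.Nat using (ℕ; zero; suc; _≥_)
open import Data.Nat.Properties using (+-suc)
open import Data.Fin using (Fin; zero; suc)
open import Data.Maybe using (Maybe; just; nothing)
open import Data.Bool using (Bool; true; false; _∧_; _∨_; not)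
open import Data.Bool.Properties using (¬-not; ⇔→≡)
open import Data.Product using (∃; _×_; _,_)
open import Data.Sum using (_⊎_; inj₁; inj₂)
open import Function.Base using (_∘_)
open import Function.Bundles using (mk⇔)
open import Relation.Nullary using (¬_; contradiction)
open import Relation.Binary.PropositionalEquality as ≡ using (_≡_; _≢_; cong; cong₂)
import Algebra.Properties.CommutativeSemigroup as CommutativeSemigroupProperties
import Algebra.Properties.AbelianGroup as AbelianGroupProperties
import Algebra.Properties.Group as GroupProperties
import Algebra.Properties.Ring as RingProperties
import Algebra.Properties.Semiring.Sum as SemiringSum
import Relation.Binary.Reasoning.Setoid as SetoidReasoning

private
  ∧-intro : ∀ {a b} → a ≡ true → b ≡ true → a ∧ b ≡ true
  ∧-intro ≡.refl ≡.refl = ≡.refl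

  ∧-elim : ∀ {a b} → a ∧ b ≡ true → a ≡ true × b ≡ true
  ∧-elim {true} b≡true = ≡.refl , b≡true

  ∨-introˡ : ∀ {a b} → a ≡ true → a ∨ b ≡ true
  ∨-introˡ ≡.refl = ≡.refl

  ∨-introʳ : ∀ a {b} → b ≡ true → a ∨ b ≡ true
  ∨-introʳ true  _      = ≡.refl
  ∨-introʳ false b≡true = b≡true

  ∨-elim : ∀ {a b} → a ∨ b ≡ true → a ≡ true ⊎ b ≡ true
  ∨-elim {true}  _      = inj₁ ≡.refl
  ∨-elim {false} b≡true = inj₂ b≡true

eqF-refl : ∀ {n} (x : Fin n) → eqF x x ≡ true
eqF-refl zero    = ≡.refl
eqF-refl (suc x) = eqF-refl x

eqF-comm : ∀ {n} (x y : Fin n) → eqF x y ≡ eqF y x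
eqF-comm zero    zero    = ≡.refl
eqF-comm zero    (suc _) = ≡.refl
eqF-comm (suc _) zero    = ≡.refl
eqF-comm (suc x) (suc y) = eqF-comm x y

eqF⇒≡ : ∀ {n} {x y : Fin n} → eqF x y ≡ true → x ≡ y
eqF⇒≡ {x = zero}  {zero}  _  = ≡.refl
eqF⇒≡ {x = suc x} {suc y} xy = cong suc (eqF⇒≡ xy)

anyF⁺ : ∀ {n} (p : Fin n → Bool) {k} → p k ≡ true → anyF p ≡ true
anyF⁺ p {zero}  pk = ∨-introˡ pk
anyF⁺ p {suc k} pk = ∨-introʳ (p zero) (anyF⁺ (λ i → p (suc i)) pk)

anyF⁻ : ∀ {n} (p : Fin n → Bool) → anyF p ≡ true → ∃ λ k → p k ≡ true
anyF⁻ {suc n} p any with ∨-elim {p zero} any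
... | inj₁ p0 = zero , p0
... | inj₂ any′ with k , pk ← anyF⁻ (λ i → p (suc i)) any′ = suc k , pk

countF-suc : ∀ {n} (p : Fin n → Bool) {k} → p k ≡ true → ∃ λ m → countF p ≡ suc m
countF-suc p {zero}  pk rewrite pk = _ , ≡.refl
countF-suc p {suc k} pk with m , count≡ ← countF-suc (λ i → p (suc i)) pk rewrite count≡ =
  _ , +-suc _ m

module _ {n} (G : SimpleGraph n) where

  within-suc⁺ : ∀ {x y z} i → within G x z i ≡ true → adj G z y ≡ true →
    within G x y (suc i) ≡ true
  within-suc⁺ {x} {y} i xz zy =
    ∨-introʳ (within G x y i) (anyF⁺ (λ z → within G x z i ∧ adj G z y) (∧-intro xz zy))

  within-suc⁻ : ∀ {x y} i → within G x y (suc i) ≡ true →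
    within G x y i ≡ true ⊎ ∃ λ z → within G x z i ≡ true × adj G z y ≡ true
  within-suc⁻ {x} {y} i xy with ∨-elim {within G x y i} xy
  ... | inj₁ xy′ = inj₁ xy′
  ... | inj₂ via with z , xz∧zy ← anyF⁻ (λ z → within G x z i ∧ adj G z y) via =
    inj₂ (z , ∧-elim xz∧zy)

  within⇒within-suc : ∀ {x y} i → within G x y i ≡ true → within G x y (suc i) ≡ true
  within⇒within-suc _ = ∨-introˡ

  within-step : ∀ {w x y} i → adj G w x ≡ true → within G x y i ≡ true → within G w y (suc i) ≡ true
  within-step {w} {x} {y} zero wx xy with ≡.refl ← eqF⇒≡ {x = x} {y} xy =
    within-suc⁺ {x = w} zero (eqF-refl w) wx
  within-step (suc i) wx xy with within-suc⁻ i xy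
  ... | inj₁ xy′          = within⇒within-suc (suc i) (within-step i wx xy′)
  ... | inj₂ (_ , xz , zy) = within-suc⁺ (suc i) (within-step i wx xz) zy

  within-sym : ∀ {x y} i → within G x y i ≡ true → within G y x i ≡ true
  within-sym {x} {y} zero xy = ≡.trans (eqF-comm y x) xy
  within-sym {y = y} (suc i) xy with within-suc⁻ i xy
  ... | inj₁ xy′          = within⇒within-suc i (within-sym i xy′)
  ... | inj₂ (z , xz , zy) = within-step i (≡.trans (adj-sym G y z) zy) (within-sym i xz)

  within-comm : ∀ {x y} i → within G x y i ≡ within G y x i
  within-comm i = ⇔→≡ (mk⇔ (within-sym i) (within-sym i))

  atDist-comm : ∀ {x y} i → atDist G x y i ≡ atDist G y x i
  atDist-comm {x} {y} zero = eqF-comm x y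
  atDist-comm (suc i) = cong₂ (λ a b → a ∧ not b) (within-comm (suc i)) (within-comm i)

  adj⇒≢ : ∀ {x y} → adj G x y ≡ true → x ≢ y
  adj⇒≢ {x} xx ≡.refl = contradiction (≡.trans (≡.sym (adj-irref G x)) xx) λ ()

  adj⇒atDist₁ : ∀ {x y} → adj G x y ≡ true → atDist G x y 1 ≡ true
  adj⇒atDist₁ {x} xy =
    ∧-intro (within-suc⁺ {x = x} zero (eqF-refl x) xy) (cong not (¬-not (adj⇒≢ xy ∘ eqF⇒≡)))

  within⇒atDist-suc≡false : ∀ {x y} i → within G x y i ≡ true → atDist G x y (suc i) ≡ false
  within⇒atDist-suc≡false i xy rewrite xy = ≡.refl

  atDist-suc⇒∃adj : ∀ {x y} i → atDist G x y (suc i) ≡ true →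
    ∃ λ z → within G x z i ≡ true × adj G z y ≡ true
  atDist-suc⇒∃adj i xy with xy-within , xy-not ← ∧-elim xy with within-suc⁻ i xy-within
  ... | inj₁ xy′   = contradiction (≡.trans (≡.sym (cong not xy′)) xy-not) λ ()
  ... | inj₂ close = close

  atDist-suc⇒∃neighbour-closer : ∀ {u v} i → atDist G u v (suc i) ≡ true →
    ∃ λ z → atDist G z u 1 ≡ true × atDist G z v (suc i) ≡ false
  atDist-suc⇒∃neighbour-closer i uv
    with z , vz , zu ← atDist-suc⇒∃adj i (≡.trans (atDist-comm (suc i)) uv) =
    z , adj⇒atDist₁ zu , within⇒atDist-suc≡false i (within-sym i vz)

module _ {c ℓ} (F : Field c ℓ) where

  open Field F hiding (zero)
  open SetoidReasoning setoid
  open SemiringSum semiring using (sum; sum-cong-≋; ∑-distrib-+; *-distribˡ-sum)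
  open RingProperties ring using (-‿distribˡ-*; [y-z]x≈yx-zx)
  open GroupProperties +-group using (x∙y⁻¹≈ε⇒x≈y; ε⁻¹≈ε)
  open AbelianGroupProperties +-abelianGroup using (⁻¹-anti-homo‿-)
  open CommutativeSemigroupProperties *-commutativeSemigroup using (x∙yz≈y∙xz)

  private
    infix  4 _≈ᴹ_
    infixl 6 _-ᴹ_
    infixl 7 _·ᴹ_

    _≈ᴹ_ : ∀ {n} → Mat F n → Mat F n → Set ℓ
    _≈ᴹ_ = _≈M_ F

    _-ᴹ_ : ∀ {n} → Mat F n → Mat F n → Mat F n
    _-ᴹ_ = _-M_ F

    _·ᴹ_ : ∀ {n} → Mat F n → Mat F n → Mat F n
    _·ᴹ_ = _·M_ F

  [x-y]-[x-z]≈z-y : ∀ x y z → (x - y) - (x - z) ≈ z - y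
  [x-y]-[x-z]≈z-y x y z = begin
    (x - y) - (x - z)      ≈⟨ +-congˡ (⁻¹-anti-homo‿- x z) ⟩
    (x - y) + (z - x)      ≈⟨ +-comm (x - y) (z - x) ⟩
    (z - x) + (x - y)      ≈⟨ +-assoc z (- x) (x - y) ⟩
    z + (- x + (x - y))    ≈⟨ +-congˡ (+-assoc (- x) x (- y)) ⟨
    z + ((- x + x) - y)    ≈⟨ +-congˡ (+-congʳ (-‿inverseˡ x)) ⟩
    z + (0# - y)           ≈⟨ +-congˡ (+-identityˡ (- y)) ⟩
    z - y                  ∎

  *-invertˡ : ∀ {t t⁻¹ y z} → t * t⁻¹ ≈ 1# → t * y ≈ z → y ≈ t⁻¹ * z
  *-invertˡ {t} {t⁻¹} {y} {z} tt⁻¹≈1 ty≈z = begin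
    y              ≈⟨ *-identityˡ y ⟨
    1# * y         ≈⟨ *-congʳ (trans (*-comm t⁻¹ t) tt⁻¹≈1) ⟨
    t⁻¹ * t * y    ≈⟨ *-assoc t⁻¹ t y ⟩
    t⁻¹ * (t * y)  ≈⟨ *-congˡ ty≈z ⟩
    t⁻¹ * z        ∎

  x*y≈0⇒x≈0 : ∀ {x y} → ¬ y ≈ 0# → x * y ≈ 0# → x ≈ 0#
  x*y≈0⇒x≈0 {x} {y} y≉0 xy≈0 with y⁻¹ , yy⁻¹≈1 ← inverse y y≉0 =
    trans (*-invertˡ yy⁻¹≈1 (trans (*-comm y x) xy≈0)) (zeroʳ y⁻¹)

  x≉y⇒y-x≉0 : ∀ {x y} → ¬ x ≈ y → ¬ y - x ≈ 0#
  x≉y⇒y-x≉0 x≉y y-x≈0 = x≉y (sym (x∙y⁻¹≈ε⇒x≈y _ _ y-x≈0))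

  sumF≡sum : ∀ {n} (f : Fin n → Carrier) → sumF F f ≡ sum f
  sumF≡sum {zero}  f = ≡.refl
  sumF≡sum {suc n} f = cong (f zero +_) (sumF≡sum (λ i → f (suc i)))

  sumF-cong : ∀ {n} {f g : Fin n → Carrier} → (∀ w → f w ≈ g w) → sumF F f ≈ sumF F g
  sumF-cong {f = f} {g} f≈g = begin
    sumF F f  ≡⟨ sumF≡sum f ⟩
    sum f     ≈⟨ sum-cong-≋ f≈g ⟩
    sum g     ≡⟨ sumF≡sum g ⟨
    sumF F g  ∎

  sumF-+ : ∀ {n} (f g : Fin n → Carrier) → sumF F (λ w → f w + g w) ≈ sumF F f + sumF F g
  sumF-+ f g = begin
    sumF F (λ w → f w + g w)  ≡⟨ sumF≡sum (λ w → f w + g w) ⟩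
    sum (λ w → f w + g w)     ≈⟨ ∑-distrib-+ f g ⟩
    sum f + sum g             ≡⟨ cong₂ _+_ (sumF≡sum f) (sumF≡sum g) ⟨
    sumF F f + sumF F g       ∎

  sumF-*ˡ : ∀ {n} t (f : Fin n → Carrier) → sumF F (λ w → t * f w) ≈ t * sumF F f
  sumF-*ˡ t f = begin
    sumF F (λ w → t * f w)  ≡⟨ sumF≡sum (λ w → t * f w) ⟩
    sum (λ w → t * f w)     ≈⟨ *-distribˡ-sum t f ⟨
    t * sum f               ≡⟨ cong (t *_) (sumF≡sum f) ⟨
    t * sumF F f            ∎

  boolF-∧ : ∀ a b → boolF F a * boolF F b ≈ boolF F (a ∧ b)
  boolF-∧ true  _ = *-identityˡ _
  boolF-∧ false _ = zeroˡ _

  sumF-boolF : ∀ {n} (p : Fin n → Bool) → sumF F (λ w → boolF F (p w)) ≈ natF F (countF p)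
  sumF-boolF {zero}  p = refl
  sumF-boolF {suc n} p with p zero
  ... | true  = +-congˡ (sumF-boolF (λ i → p (suc i)))
  ... | false = trans (+-identityˡ _) (sumF-boolF (λ i → p (suc i)))

  sumF-δ : ∀ {n} (x : Fin n) (f : Fin n → Carrier) → sumF F (λ w → boolF F (eqF x w) * f w) ≈ f x
  sumF-δ {suc n} zero f = begin
    1# * f zero + sumF F (λ w → 0# * f (suc w))
      ≈⟨ +-cong (*-identityˡ _) (trans (sumF-*ˡ 0# (λ w → f (suc w))) (zeroˡ _)) ⟩
    f zero + 0#  ≈⟨ +-identityʳ _ ⟩
    f zero       ∎
  sumF-δ (suc x) f = trans (+-cong (zeroˡ _) (sumF-δ x (λ w → f (suc w)))) (+-identityˡ _)

  ·ᴹ-congˡ : ∀ {n} (X : Mat F n) {Y Z : Mat F n} → Y ≈ᴹ Z → X ·ᴹ Y ≈ᴹ X ·ᴹ Z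
  ·ᴹ-congˡ X Y≈Z x y = sumF-cong (λ w → *-congˡ (Y≈Z w y))

  ·ᴹ-scalʳ : ∀ {n} (X : Mat F n) k (Y : Mat F n) → X ·ᴹ scal F k Y ≈ᴹ scal F k (X ·ᴹ Y)
  ·ᴹ-scalʳ X k Y x y =
    trans (sumF-cong (λ w → x∙yz≈y∙xz (X x w) k (Y w y))) (sumF-*ˡ k (λ w → X x w * Y w y))

  [X-θI]Y≈XY-θY : ∀ {n} θ (X Y : Mat F n) →
    (X -ᴹ scal F θ (idM F)) ·ᴹ Y ≈ᴹ X ·ᴹ Y -ᴹ scal F θ Y
  [X-θI]Y≈XY-θY θ X Y x y = begin
    sumF F (λ w → (X x w - θ * idM F x w) * Y w y)
      ≈⟨ sumF-cong (λ w → expand (X x w) θ (idM F x w) (Y w y)) ⟩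
    sumF F (λ w → X x w * Y w y + - θ * (idM F x w * Y w y))
      ≈⟨ sumF-+ (λ w → X x w * Y w y) (λ w → - θ * (idM F x w * Y w y)) ⟩
    (X ·ᴹ Y) x y + sumF F (λ w → - θ * (idM F x w * Y w y))
      ≈⟨ +-congˡ (sumF-*ˡ (- θ) (λ w → idM F x w * Y w y)) ⟩
    (X ·ᴹ Y) x y + - θ * sumF F (λ w → idM F x w * Y w y)
      ≈⟨ +-congˡ (*-congˡ (sumF-δ x (λ w → Y w y))) ⟩
    (X ·ᴹ Y) x y + - θ * Y x y
      ≈⟨ +-congˡ (-‿distribˡ-* θ (Y x y)) ⟨
    (X ·ᴹ Y) x y - θ * Y x y
      ∎
    where
    expand : ∀ a t e b → (a - t * e) * b ≈ a * b + - t * (e * b)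
    expand a t e b =
      trans ([y-z]x≈yx-zx b a (t * e)) (+-congˡ (trans (-‿cong (*-assoc t e b)) (-‿distribˡ-* t (e * b))))

  module _ {n} (G : SimpleGraph n) where

    distMat-·ᴹ-distMat : ∀ i j x y →
      (distMat F G i ·ᴹ distMat F G j) x y ≈ natF F (countF (λ w → atDist G x w i ∧ atDist G w y j))
    distMat-·ᴹ-distMat i j x y =
      trans (sumF-cong (λ w → boolF-∧ (atDist G x w i) (atDist G w y j)))
        (sumF-boolF (λ w → atDist G x w i ∧ atDist G w y j))

    Mθ∩Mθ′⇒M∞ : ∀ {D θ θ′} {Y : Mat F n} → ¬ θ ≈ θ′ →
      InMθ F G D (just θ) Y → InMθ F G D (just θ′) Y → InMθ F G D nothing Y
    Mθ∩Mθ′⇒M∞ {D} {θ} {θ′} {Y} θ≉θ′ (_ , b , [A-θI]Y≈bA_D) (_ , b′ , [A-θ′I]Y≈b′A_D)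
      with t⁻¹ , tt⁻¹≈1 ← inverse (θ′ - θ) (x≉y⇒y-x≉0 θ≉θ′) =
      t⁻¹ * (b - b′) , λ x y → trans (*-invertˡ tt⁻¹≈1 (scaled x y)) (sym (*-assoc t⁻¹ (b - b′) _))
      where
      A = adjMat F G
      scaled : ∀ x y → (θ′ - θ) * Y x y ≈ (b - b′) * distMat F G D x y
      scaled x y = begin
        (θ′ - θ) * Y x y
          ≈⟨ [y-z]x≈yx-zx (Y x y) θ′ θ ⟩
        θ′ * Y x y - θ * Y x y
          ≈⟨ [x-y]-[x-z]≈z-y ((A ·ᴹ Y) x y) (θ * Y x y) (θ′ * Y x y) ⟨
        ((A ·ᴹ Y) x y - θ * Y x y) - ((A ·ᴹ Y) x y - θ′ * Y x y)
          ≈⟨ +-cong (trans (sym ([X-θI]Y≈XY-θY θ A Y x y)) ([A-θI]Y≈bA_D x y))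
                    (-‿cong (trans (sym ([X-θI]Y≈XY-θY θ′ A Y x y)) ([A-θ′I]Y≈b′A_D x y))) ⟩
        b * distMat F G D x y - b′ * distMat F G D x y
          ≈⟨ [y-z]x≈yx-zx _ b b′ ⟨
        (b - b′) * distMat F G D x y
          ∎

    kA_D∈Mθ⇒k≈0 : CharZero F → ∀ {i u v θ k b} {Y : Mat F n} → atDist G u v (suc i) ≡ true →
      Y ≈ᴹ scal F k (distMat F G (suc i)) →
      (adjMat F G -ᴹ scal F θ (idM F)) ·ᴹ Y ≈ᴹ scal F b (distMat F G (suc i)) → k ≈ 0#
    kA_D∈Mθ⇒k≈0 char0 {i} {_} {v} {θ} {k} {b} {Y} uv Y≈kA_D [A-θI]Y≈bA_D
      with z , zu , zv ← atDist-suc⇒∃neighbour-closer G i uv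
      with m , count≡ ← countF-suc (λ w → atDist G z w 1 ∧ atDist G w v (suc i)) (∧-intro zu uv) =
      x*y≈0⇒x≈0 (char0 m) (begin
        k * natF F (suc m)                    ≡⟨ cong (λ c → k * natF F c) count≡ ⟨
        k * natF F (countF (λ w → atDist G z w 1 ∧ atDist G w v (suc i)))
                                              ≈⟨ *-congˡ (distMat-·ᴹ-distMat 1 (suc i) z v) ⟨
        k * (A ·ᴹ A_D) z v                    ≈⟨ ·ᴹ-scalʳ A k A_D z v ⟨
        (A ·ᴹ scal F k A_D) z v               ≈⟨ ·ᴹ-congˡ A Y≈kA_D z v ⟨
        (A ·ᴹ Y) z v                          ≈⟨ +-identityʳ _ ⟨
        (A ·ᴹ Y) z v + 0#                     ≈⟨ +-congˡ (trans (-‿cong θY[z,v]≈0) ε⁻¹≈ε) ⟨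
        (A ·ᴹ Y) z v - θ * Y z v              ≈⟨ [X-θI]Y≈XY-θY θ A Y z v ⟨
        ((A -ᴹ scal F θ (idM F)) ·ᴹ Y) z v    ≈⟨ [A-θI]Y≈bA_D z v ⟩
        b * A_D z v                           ≈⟨ *-congˡ A_D[z,v]≈0 ⟩
        b * 0#                                ≈⟨ zeroʳ b ⟩
        0#                                    ∎)
      where
      A = adjMat F G
      A_D = distMat F G (suc i)

      A_D[z,v]≈0 : A_D z v ≈ 0#
      A_D[z,v]≈0 = reflexive (cong (boolF F) zv)

      θY[z,v]≈0 : θ * Y z v ≈ 0#
      θY[z,v]≈0 = trans (*-congˡ (trans (Y≈kA_D z v) (trans (*-congˡ A_D[z,v]≈0) (zeroʳ k)))) (zeroʳ θ)

    M∞∩Mθ⇒≈0 : CharZero F → ∀ {i u v θ} {Y : Mat F n} → atDist G u v (suc i) ≡ true →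
      InMθ F G (suc i) nothing Y → InMθ F G (suc i) (just θ) Y → ∀ x y → Y x y ≈ 0#
    M∞∩Mθ⇒≈0 char0 {i} {Y = Y} uv (k , Y≈kA_D) (_ , _ , [A-θI]Y≈bA_D) x y = begin
      Y x y                            ≈⟨ Y≈kA_D x y ⟩
      k * distMat F G (suc i) x y      ≈⟨ *-congʳ (kA_D∈Mθ⇒k≈0 char0 {i} uv Y≈kA_D [A-θI]Y≈bA_D) ⟩
      0# * distMat F G (suc i) x y     ≈⟨ zeroˡ _ ⟩
      0#                               ∎

lemma6p5 : ∀ {c ℓ} (F : Field c ℓ) → CharZero F →
    ∀ {n : ℕ} (G : SimpleGraph n) (D : ℕ) →
    DistanceRegular G → HasDiameter G D → D ≥ 3 →
    (θ θ' : Maybe (Field.Carrier F)) → DistinctExt F θ θ' →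
    (Y : Mat F n) → InMθ F G D θ Y → InMθ F G D θ' Y →
    (x y : Fin n) → Field._≈_ F (Y x y) (Field.0# F)
lemma6p5 F char0 G (suc _) _ (_ , _ , _ , uv) _ (just _) nothing _ _ Y∈Mθ Y∈M∞ =
  M∞∩Mθ⇒≈0 F G char0 uv Y∈M∞ Y∈Mθ
lemma6p5 F char0 G (suc _) _ (_ , _ , _ , uv) _ nothing (just _) _ _ Y∈M∞ Y∈Mθ′ =
  M∞∩Mθ⇒≈0 F G char0 uv Y∈M∞ Y∈Mθ′
lemma6p5 F char0 G (suc _) _ (_ , _ , _ , uv) _ (just _) (just _) θ≉θ′ _ Y∈Mθ Y∈Mθ′ =
  M∞∩Mθ⇒≈0 F G char0 uv (Mθ∩Mθ′⇒M∞ F G θ≉θ′ Y∈Mθ Y∈Mθ′) Y∈Mθ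
lemma6p5 _ _ _ (suc _) _ _ _ nothing nothing (lift ()) _ _ _
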